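{- Let $v$ be a value and let there be a derivation in system $\mathcal{V}$ of $\Gamma\vdash^{(m,e,s)} v:\mathcal{M}$, where $\mathcal{M}=\bigsqcup_{i\in I}\mathcal{M}_i$ for a finite index set $I$ and multitypes $\mathcal{M}_i$. Then there exist contexts $\Gamma_i$, integers $m_i,e_i,s_i$ and derivations in system $\mathcal{V}$ of $\Gamma_i\vdash^{(m_i,e_i,s_i)} v:\mathcal{M}_i$ for each $i\in I$, such that $\Gamma=+_{i\in I}\Gamma_i$, $m=\sum_{i\in I}m_i$, $e=1+\sum_{i\in I}e_i-|I|$, and $s=\sum_{i\in I}s_i$.
   Context: Terms are $t,u,r ::= x \mid \lambda x.t \mid t\,u \mid t[x\backslash u]$ over a countably infinite set of variables, where $t[x\backslash u]$ (explicit substitution) binds $x$ in $t$; terms are taken modulo $\alpha$-conversion. Values are $v ::= x \mid \lambda x.t$. Types. Tight types: $\mathtt{tt} ::= \mathtt{n} \mid \mathtt{vl} \mid \mathtt{vr}$. Types $\sigma,\tau ::= \mathtt{tt}\mid\mathcal{M}\mid\mathcal{M}\to\sigma$, with multitypes $\mathcal{M}=[\sigma_i]_{i\in I}$ finite multisets of types ($[\,]$ empty, $\sqcup$ union, $|I|$ the cardinality of $I$). Typing contexts $\Gamma$ map variables to multitypes, $[\,]$ for all but finitely many; $(\Gamma+\Delta)(x)=\Gamma(x)\sqcup\Delta(x)$, extended to finite sums; $\Gamma\setminus\!\!\setminus x$ maps $x$ to $[\,]$ and agrees with $\Gamma$ elsewhere. Judgements $\Gamma\vdash^{(m,e,s)}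 t:\sigma$ carry integer counters. System $\mathcal{V}$ has the rules: (var$_p$) $x:[\mathtt{vr}]\vdash^{(0,0,0)} x:\mathtt{vr}$; (val$_p$) $\emptyset\vdash^{(0,0,0)} x:\mathtt{vl}$; (abs$_p$) $\emptyset\vdash^{(0,0,0)}\lambda x.t:\mathtt{vl}$; (app$_p$) from $\Gamma\vdash^{(m,e,s)} t:\mathtt{tt}_1$ with $\mathtt{tt}_1\in\{\mathtt{vr},\mathtt{n}\}$ and $\Delta\vdash^{(m',e',s')} u:\mathtt{tt}_2$ with $\mathtt{tt}_2\in\{\mathtt{vl},\mathtt{n}\}$, infer $\Gamma+\Delta\vdash^{(m+m',e+e',s+s'+1)} t\,u:\mathtt{n}$; (es$_p$) from $\Gamma\vdash^{(m,e,s)} t:\tau$, $\Delta\vdash^{(m',e',s')} u:\mathtt{n}$ and $\Gamma(x)$ tight, infer $(\Gamma\setminus\!\!\setminus x)+\Delta\vdash^{(m+m',e+e',s+s')} t[x\backslash u]:\tau$; (var$_c$) $x:\mathcal{M}\vdash^{(0,1,0)} x:\mathcal{M}$ for any multitype $\mathcal{M}$; (app$_c$) from $\Gamma\vdash^{(m,e,s)} t:[\mathcal{M}\to\tau]$ and $\Delta\vdash^{(m',e',s')} u:\mathcal{M}$, infer $\Gamma+\Delta\vdash^{(m+m'+1,e+e'-1,s+s')} t\,u:\tau$; (appt$_c$) from $\Gamma\vdash^{(m,e,s)} t:[\mathcal{M}\to\tau]$, $\Delta\vdash^{(m',e',s')} u:\mathtt{n}$ and $\mathcal{M}$ tight, infer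 $\Gamma+\Delta\vdash^{(m+m'+1,e+e'-1,s+s')} t\,u:\tau$; (abs$_c$) from $\Gamma_i\vdash^{(m_i,e_i,s_i)} t:\tau_i$ for each $i\in I$ ($I$ finite, possibly empty), infer $+_{i\in I}(\Gamma_i\setminus\!\!\setminus x)\vdash^{(\sum_i m_i,\,1+\sum_i e_i,\,\sum_i s_i)}\lambda x.t:[\Gamma_i(x)\to\tau_i]_{i\in I}$; (es$_c$) from $\Gamma\vdash^{(m,e,s)} t:\sigma$ and $\Delta\vdash^{(m',e',s')} u:\Gamma(x)$, infer $(\Gamma\setminus\!\!\setminus x)+\Delta\vdash^{(m+m',e+e',s+s')} t[x\backslash u]:\sigma$. A multitype is tight if all its elements are tight types. -}

module Defs where

open import Data.Nat using (ℕ; _≡ᵇ_)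
open import Data.Bool using (if_then_else_)
open import Data.Integer using (ℤ; 0ℤ; 1ℤ; _+_; _-_; +_)
open import Data.List using (List; []; _∷_; [_]; _++_)
open import Data.List.Relation.Unary.All using (All)
open import Data.Fin using (Fin; zero; suc)
open import Data.List.Relation.Binary.Permutation.Homogeneous using (Permutation)

Var : Set
Var = ℕ

data Tm : Set where
  var : Var → Tm
  lam : Var → Tm → Tm
  app : Tm → Tm → Tm
  esub : Tm → Var → Tm → Tm     -- esub t x u  =  t[x\u]

data Value : Tm → Set where
  var-val : ∀ x → Value (var x)
  lam-val : ∀ x t → Value (lam x t)

-- Types; a multitype is a finite multiset, represented by a list
-- considered up to (deep) permutation.

data Ty : Set where
  tn  : Ty
  tvl : Ty
  tvr : Ty
  mult : List Ty → Ty
  arr  : List Ty → Ty → Ty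

MTy : Set
MTy = List Ty

data Tight : Ty → Set where
  tight-n  : Tight tn
  tight-vl : Tight tvl
  tight-vr : Tight tvr

TightM : MTy → Set
TightM = All Tight

data VrN : Ty → Set where
  vrn-vr : VrN tvr
  vrn-n  : VrN tn

data VlN : Ty → Set where
  vln-vl : VlN tvl
  vln-n  : VlN tn

mutual
  data _≈T_ : Ty → Ty → Set where
    ≈n    : tn ≈T tn
    ≈vl   : tvl ≈T tvl
    ≈vr   : tvr ≈T tvr
    ≈mult : ∀ {M N} → M ≈M N → mult M ≈T mult N
    ≈arr  : ∀ {M N σ τ} → M ≈M N → σ ≈T τ → arr M σ ≈T arr N τ

  data _≈M_ : MTy → MTy → Set where
    perm : ∀ {M N} → Permutation _≈T_ M N → M ≈M N

Ctx : Set
Ctx = Var → MTy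

∅ : Ctx
∅ _ = []

_⊕_ : Ctx → Ctx → Ctx
(Γ ⊕ Δ) y = Γ y ++ Δ y

_∖∖_ : Ctx → Var → Ctx
(Γ ∖∖ x) y = if y ≡ᵇ x then [] else Γ y

⟨_∶_⟩ : Var → MTy → Ctx
⟨ x ∶ M ⟩ y = if y ≡ᵇ x then M else []

_≈C_ : Ctx → Ctx → Set
Γ ≈C Δ = ∀ y → Γ y ≈M Δ y

-- System V:  Der Γ m e s t σ  is  Γ ⊢^(m,e,s) t : σ

mutual
  data Der : Ctx → ℤ → ℤ → ℤ → Tm → Ty → Set where
    var-p : ∀ {x} → Der ⟨ x ∶ [ tvr ] ⟩ 0ℤ 0ℤ 0ℤ (var x) tvr
    val-p : ∀ {x} → Der ∅ 0ℤ 0ℤ 0ℤ (var x) tvl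
    abs-p : ∀ {x t} → Der ∅ 0ℤ 0ℤ 0ℤ (lam x t) tvl
    app-p : ∀ {Γ Δ m e s m' e' s' t u tt₁ tt₂} →
            Der Γ m e s t tt₁ → VrN tt₁ →
            Der Δ m' e' s' u tt₂ → VlN tt₂ →
            Der (Γ ⊕ Δ) (m + m') (e + e') (s + s' + 1ℤ) (app t u) tn
    es-p  : ∀ {Γ Δ m e s m' e' s' t u x τ} →
            Der Γ m e s t τ → Der Δ m' e' s' u tn → TightM (Γ x) →
            Der ((Γ ∖∖ x) ⊕ Δ) (m + m') (e + e') (s + s') (esub t x u) τ
    var-c : ∀ {x M} → Der ⟨ x ∶ M ⟩ 0ℤ 1ℤ 0ℤ (var x) (mult M)
    app-c : ∀ {Γ Δ m e s m' e' s' t u M N τ} →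
            Der Γ m e s t (mult [ arr M τ ]) →
            Der Δ m' e' s' u (mult N) → N ≈M M →
            Der (Γ ⊕ Δ) (m + m' + 1ℤ) (e + e' - 1ℤ) (s + s') (app t u) τ
    appt-c : ∀ {Γ Δ m e s m' e' s' t u M τ} →
            Der Γ m e s t (mult [ arr M τ ]) →
            Der Δ m' e' s' u tn → TightM M →
            Der (Γ ⊕ Δ) (m + m' + 1ℤ) (e + e' - 1ℤ) (s + s') (app t u) τ
    abs-c : ∀ {Γ m e s x t M} →
            AbsPrems x t Γ m e s M →
            Der Γ m (1ℤ + e) s (lam x t) (mult M)
    es-c  : ∀ {Γ Δ m e s m' e' s' t u x σ N} →
            Der Γ m e s t σ → Der Δ m' e' s' u (mult N) → N ≈M Γ x →
            Der ((Γ ∖∖ x) ⊕ Δ) (m + m') (e + e') (s + s') (esub t x u) σ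

  -- the finite family of premises of abs-c, accumulating
  -- +_i (Γ_i \\ x), Σ m_i, Σ e_i, Σ s_i and [Γ_i(x) → τ_i]_i
  data AbsPrems (x : Var) (t : Tm) : Ctx → ℤ → ℤ → ℤ → MTy → Set where
    []  : AbsPrems x t ∅ 0ℤ 0ℤ 0ℤ []
    _∷_ : ∀ {Γ Δ m e s m' e' s' τ M} →
          Der Γ m e s t τ → AbsPrems x t Δ m' e' s' M →
          AbsPrems x t ((Γ ∖∖ x) ⊕ Δ) (m + m') (e + e') (s + s')
                   (arr (Γ x) τ ∷ M)

sumℤ : ∀ {n} → (Fin n → ℤ) → ℤ
sumℤ {ℕ.zero}  f = 0ℤ
sumℤ {ℕ.suc n} f = f zero + sumℤ (λ i → f (suc i))

⨆ : ∀ {n} → (Fin n → MTy) → MTy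
⨆ {ℕ.zero}  f = []
⨆ {ℕ.suc n} f = f zero ++ ⨆ (λ i → f (suc i))

sumCtx : ∀ {n} → (Fin n → Ctx) → Ctx
sumCtx {ℕ.zero}  f = ∅
sumCtx {ℕ.suc n} f = f zero ⊕ sumCtx (λ i → f (suc i))

{-# OPTIONS --safe #-}
-- A derivation of a value at a multitype M₁ ⊔ … ⊔ Mₙ is either var-c, whose
-- context x : M splits into the contexts x : Mᵢ, or abs-c, which has one
-- premise per element of the multitype. Permuting these premises so that they
-- follow the decomposition and cutting the list into n blocks gives, via
-- abs-c on every block, the derivations of the Mᵢ; contexts and the m, s
-- counters add up. Each block pays its own 1 in the e counter, hence the
-- correction 1 - n.
module Submission where

open import Defs
open import Data.Nat using (ℕ; zero; suc; _≡ᵇ_)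
open import Data.Fin using (Fin; zero; suc)
open import Data.Integer using (ℤ; 0ℤ; 1ℤ; _+_; _-_; _*_; +_)
import Data.Integer.Properties as ℤ
open import Data.Integer.Tactic.RingSolver using (solve-∀)
open import Data.Bool using (true; false)
open import Data.List using ([]; _∷_; _++_)
open import Data.List.Relation.Binary.Pointwise using (Pointwise; []; _∷_)
import Data.List.Relation.Binary.Permutation.Homogeneous as Homogeneous
open import Data.Product using (Σ; _×_; _,_)
open import Relation.Binary.Bundles using (Setoid)
open import Relation.Binary.PropositionalEquality
  using (_≡_; refl; sym; trans; cong; subst; module ≡-Reasoning)

mutual
  ≈T-refl : ∀ σ → σ ≈T σ
  ≈T-refl tn        = ≈n
  ≈T-refl tvl       = ≈vl
  ≈T-refl tvr       = ≈vr
  ≈T-refl (mult M)  = ≈mult (≈M-refl M)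
  ≈T-refl (arr M σ) = ≈arr (≈M-refl M) (≈T-refl σ)

  ≈M-refl : ∀ M → M ≈M M
  ≈M-refl M = perm (Homogeneous.refl (pointwise-refl M))

  pointwise-refl : ∀ M → Pointwise _≈T_ M M
  pointwise-refl []      = []
  pointwise-refl (σ ∷ M) = ≈T-refl σ ∷ pointwise-refl M

mutual
  ≈T-sym : ∀ {σ τ} → σ ≈T τ → τ ≈T σ
  ≈T-sym ≈n         = ≈n
  ≈T-sym ≈vl        = ≈vl
  ≈T-sym ≈vr        = ≈vr
  ≈T-sym (≈mult p)  = ≈mult (≈M-sym p)
  ≈T-sym (≈arr p q) = ≈arr (≈M-sym p) (≈T-sym q)

  ≈M-sym : ∀ {M N} → M ≈M N → N ≈M M
  ≈M-sym (perm p) = perm (permutation-sym p)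

  permutation-sym : ∀ {M N} → Homogeneous.Permutation _≈T_ M N →
                    Homogeneous.Permutation _≈T_ N M
  permutation-sym (Homogeneous.refl p)     = Homogeneous.refl (pointwise-sym p)
  permutation-sym (Homogeneous.prep e p)   = Homogeneous.prep (≈T-sym e) (permutation-sym p)
  permutation-sym (Homogeneous.swap e f p) =
    Homogeneous.swap (≈T-sym f) (≈T-sym e) (permutation-sym p)
  permutation-sym (Homogeneous.trans p q)  =
    Homogeneous.trans (permutation-sym q) (permutation-sym p)

  pointwise-sym : ∀ {M N} → Pointwise _≈T_ M N → Pointwise _≈T_ N M
  pointwise-sym []      = []
  pointwise-sym (e ∷ p) = ≈T-sym e ∷ pointwise-sym p

≈T-trans : ∀ {σ τ ρ} → σ ≈T τ → τ ≈T ρ → σ ≈T ρ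
≈T-trans ≈n ≈n = ≈n
≈T-trans ≈vl ≈vl = ≈vl
≈T-trans ≈vr ≈vr = ≈vr
≈T-trans (≈mult (perm p)) (≈mult (perm q)) = ≈mult (perm (Homogeneous.trans p q))
≈T-trans (≈arr (perm p) a) (≈arr (perm q) b) =
  ≈arr (perm (Homogeneous.trans p q)) (≈T-trans a b)

≈T-setoid : Setoid _ _
≈T-setoid = record
  { Carrier       = Ty
  ; _≈_           = _≈T_
  ; isEquivalence = record { refl = ≈T-refl _ ; sym = ≈T-sym ; trans = ≈T-trans }
  }

open import Data.List.Relation.Binary.Equality.Setoid ≈T-setoid using (_≋_; ≋-refl; ≋-trans)
open import Data.List.Relation.Binary.Permutation.Setoid ≈T-setoid
  using (_↭_; ↭-refl; ↭-trans; ↭-sym)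
open import Data.List.Relation.Binary.Permutation.Setoid.Properties ≈T-setoid
  using (++⁺ˡ; ++-assoc; shifts)

infix 4 _∼_

_∼_ : Ctx → Ctx → Set
Γ ∼ Δ = ∀ y → Γ y ↭ Δ y

∼-trans : ∀ {Γ Δ Θ} → Γ ∼ Δ → Δ ∼ Θ → Γ ∼ Θ
∼-trans p q y = ↭-trans (p y) (q y)

⊕-congˡ : ∀ Γ {Δ Θ} → Δ ∼ Θ → Γ ⊕ Δ ∼ Γ ⊕ Θ
⊕-congˡ Γ p y = ++⁺ˡ (Γ y) (p y)

⊕-assoc : ∀ Γ Δ Θ → Γ ⊕ (Δ ⊕ Θ) ∼ (Γ ⊕ Δ) ⊕ Θ
⊕-assoc Γ Δ Θ y = ↭-sym (++-assoc (Γ y) (Δ y) (Θ y))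

⊕-shift : ∀ Γ Δ Θ → Γ ⊕ (Δ ⊕ Θ) ∼ Δ ⊕ (Γ ⊕ Θ)
⊕-shift Γ Δ Θ y = shifts (Γ y) (Δ y)

+-shift : ∀ a b c → a + (b + c) ≡ b + (a + c)
+-shift = solve-∀

sumℤ-+ : ∀ n (f g : Fin n → ℤ) → sumℤ (λ i → f i + g i) ≡ sumℤ f + sumℤ g
sumℤ-+ zero    f g = refl
sumℤ-+ (suc n) f g = begin
  (f zero + g zero) + sumℤ (λ i → f (suc i) + g (suc i))
    ≡⟨ cong (_+_ (f zero + g zero)) (sumℤ-+ n (λ i → f (suc i)) (λ i → g (suc i))) ⟩
  (f zero + g zero) + (F + G)
    ≡⟨ interchange (f zero) (g zero) F G ⟩
  (f zero + F) + (g zero + G) ∎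
  where
  open ≡-Reasoning
  F = sumℤ (λ i → f (suc i))
  G = sumℤ (λ i → g (suc i))
  interchange : ∀ a b c d → (a + b) + (c + d) ≡ (a + c) + (b + d)
  interchange = solve-∀

sumℤ-const : ∀ n c → sumℤ {n} (λ _ → c) ≡ + n * c
sumℤ-const zero    c = sym (ℤ.*-zeroˡ c)
sumℤ-const (suc n) c = begin
  c + sumℤ {n} (λ _ → c) ≡⟨ cong (_+_ c) (sumℤ-const n c) ⟩
  c + + n * c            ≡⟨ sym (ℤ.suc-* (+ n) c) ⟩
  + suc n * c            ∎
  where open ≡-Reasoning

sumCtx-⟨∶⟩ : ∀ n x (Ms : Fin n → MTy) y → sumCtx (λ i → ⟨ x ∶ Ms i ⟩) y ≡ ⟨ x ∶ ⨆ Ms ⟩ y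
sumCtx-⟨∶⟩ zero    x Ms y with y ≡ᵇ x
... | true  = refl
... | false = refl
sumCtx-⟨∶⟩ (suc n) x Ms y with y ≡ᵇ x | sumCtx-⟨∶⟩ n x (λ i → Ms (suc i)) y
... | true  | ih = cong (Ms zero ++_) ih
... | false | ih = ih

record AbsPrems≈ (x : Var) (t : Tm) (Γ : Ctx) (m e s : ℤ) (N : MTy) : Set where
  constructor up-to
  field
    {Γ′}         : Ctx
    {m′ e′ s′}   : ℤ
    {M}          : MTy
    premises     : AbsPrems x t Γ′ m′ e′ s′ M
    types        : M ≋ N
    context      : Γ ∼ Γ′
    m≡ : m ≡ m′
    e≡ : e ≡ e′
    s≡ : s ≡ s′

module _ {x : Var} {t : Tm} where

  exactly : ∀ {Γ m e s M N} → AbsPrems x t Γ m e s M → M ≋ N → AbsPrems≈ x t Γ m e s N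
  exactly P M≋N = up-to P M≋N (λ _ → ↭-refl) refl refl refl

  AbsPrems≈-resp : ∀ {Γ Γ′ m m′ e e′ s s′ N} → Γ ∼ Γ′ → m ≡ m′ → e ≡ e′ → s ≡ s′ →
                   AbsPrems≈ x t Γ′ m′ e′ s′ N → AbsPrems≈ x t Γ m e s N
  AbsPrems≈-resp Γ∼ m≡ e≡ s≡ (up-to P M≋N Γ′∼ m′≡ e′≡ s′≡) =
    up-to P M≋N (∼-trans Γ∼ Γ′∼) (trans m≡ m′≡) (trans e≡ e′≡) (trans s≡ s′≡)

  cons : ∀ {G m₀ e₀ s₀ τ σ Δ m e s N} → Der G m₀ e₀ s₀ t τ → arr (G x) τ ≈T σ →
         AbsPrems≈ x t Δ m e s N →
         AbsPrems≈ x t ((G ∖∖ x) ⊕ Δ) (m₀ + m) (e₀ + e) (s₀ + s) (σ ∷ N)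
  cons {G} {m₀} {e₀} {s₀} D a≈σ (up-to P M≋N Δ∼ m≡ e≡ s≡) =
    up-to (D ∷ P) (a≈σ ∷ M≋N) (⊕-congˡ (G ∖∖ x) Δ∼)
          (cong (_+_ m₀) m≡) (cong (_+_ e₀) e≡) (cong (_+_ s₀) s≡)

  reorder : ∀ {Γ m e s M K N} → AbsPrems x t Γ m e s M → M ≋ K → K ↭ N →
            AbsPrems≈ x t Γ m e s N
  reorder P M≋K (Homogeneous.refl K≋N) = exactly P (≋-trans M≋K K≋N)
  reorder (D ∷ P) (a≈k ∷ M≋K) (Homogeneous.prep k≈n K↭N) =
    cons D (≈T-trans a≈k k≈n) (reorder P M≋K K↭N)
  reorder (_∷_ {Γ = G₁} {m = m₁} {e = e₁} {s = s₁} D₁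
            (_∷_ {Γ = G₂} {Δ} {m₂} {e₂} {s₂} {m} {e} {s} D₂ P))
          (a≈k ∷ b≈l ∷ M≋K) (Homogeneous.swap k≈k′ l≈l′ K↭N) =
    AbsPrems≈-resp (⊕-shift (G₁ ∖∖ x) (G₂ ∖∖ x) Δ)
      (+-shift m₁ m₂ m) (+-shift e₁ e₂ e) (+-shift s₁ s₂ s)
      (cons D₂ (≈T-trans b≈l l≈l′) (cons D₁ (≈T-trans a≈k k≈k′) (reorder P M≋K K↭N)))
  reorder P M≋K (Homogeneous.trans K↭L L↭N) with reorder P M≋K K↭L
  ... | up-to P′ M′≋L Γ∼ m≡ e≡ s≡ = AbsPrems≈-resp Γ∼ m≡ e≡ s≡ (reorder P′ M′≋L L↭N)

  record Split (Γ : Ctx) (m e s : ℤ) (A B : MTy) : Set where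
    constructor split
    field
      {Γ₁ Γ₂}             : Ctx
      {m₁ e₁ s₁ m₂ e₂ s₂} : ℤ
      {M₁ M₂}             : MTy
      left        : AbsPrems x t Γ₁ m₁ e₁ s₁ M₁
      left-types  : M₁ ≋ A
      right       : AbsPrems x t Γ₂ m₂ e₂ s₂ M₂
      right-types : M₂ ≋ B
      context     : Γ ∼ Γ₁ ⊕ Γ₂
      m≡ : m ≡ m₁ + m₂
      e≡ : e ≡ e₁ + e₂
      s≡ : s ≡ s₁ + s₂

  splitAt : ∀ A {B Γ m e s M} → AbsPrems x t Γ m e s M → M ≋ A ++ B → Split Γ m e s A B
  splitAt [] {m = m} {e} {s} P M≋B =
    split [] [] P M≋B (λ _ → ↭-refl) (sym (ℤ.+-identityˡ m)) (sym (ℤ.+-identityˡ e))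
          (sym (ℤ.+-identityˡ s))
  splitAt (a ∷ A) (_∷_ {Γ = G} {m = m₀} {e = e₀} {s = s₀} D P) (d≈a ∷ M≋AB)
    with splitAt A P M≋AB
  ... | split {Γ₁} {Γ₂} {m₁} {e₁} {s₁} {m₂} {e₂} {s₂} L L≋A R R≋B Δ∼ m≡ e≡ s≡ =
    split (D ∷ L) (d≈a ∷ L≋A) R R≋B
      (∼-trans (⊕-congˡ (G ∖∖ x) Δ∼) (⊕-assoc (G ∖∖ x) Γ₁ Γ₂))
      (trans (cong (_+_ m₀) m≡) (sym (ℤ.+-assoc m₀ m₁ m₂)))
      (trans (cong (_+_ e₀) e≡) (sym (ℤ.+-assoc e₀ e₁ e₂)))
      (trans (cong (_+_ s₀) s≡) (sym (ℤ.+-assoc s₀ s₁ s₂)))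

  record Blocks (Γ : Ctx) (m e s : ℤ) (n : ℕ) (Ms : Fin n → MTy) : Set where
    constructor blocks
    field
      Γs       : Fin n → Ctx
      ms es ss : Fin n → ℤ
      block    : (i : Fin n) →
                 Σ MTy λ Ni → Ni ≋ Ms i × AbsPrems x t (Γs i) (ms i) (es i) (ss i) Ni
      context  : Γ ∼ sumCtx Γs
      m≡ : m ≡ sumℤ ms
      e≡ : e ≡ sumℤ es
      s≡ : s ≡ sumℤ ss

  splitBlocks : ∀ n (Ms : Fin n → MTy) {Γ m e s M} → AbsPrems x t Γ m e s M → M ≋ ⨆ Ms →
                Blocks Γ m e s n Ms
  splitBlocks zero Ms [] [] =
    blocks (λ ()) (λ ()) (λ ()) (λ ()) (λ ()) (λ _ → ↭-refl) refl refl refl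
  splitBlocks (suc n) Ms P M≋ with splitAt (Ms zero) P M≋
  ... | split {Γ₁} {m₁ = m₁} {e₁} {s₁} L L≋ R R≋ Γ∼ m≡ e≡ s≡
    with splitBlocks n (λ i → Ms (suc i)) R R≋
  ... | blocks Γs ms es ss block Γ₂∼ m₂≡ e₂≡ s₂≡ =
    blocks (λ { zero → Γ₁ ; (suc i) → Γs i })
           (λ { zero → m₁ ; (suc i) → ms i })
           (λ { zero → e₁ ; (suc i) → es i })
           (λ { zero → s₁ ; (suc i) → ss i })
           (λ { zero → _ , L≋ , L ; (suc i) → block i })
           (∼-trans Γ∼ (⊕-congˡ Γ₁ Γ₂∼))
           (trans m≡ (cong (_+_ m₁) m₂≡))
           (trans e≡ (cong (_+_ e₁) e₂≡))
           (trans s≡ (cong (_+_ s₁) s₂≡))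

  splitPremises : ∀ n (Ms : Fin n → MTy) {Γ m e s M} → AbsPrems x t Γ m e s M → M ↭ ⨆ Ms →
                  Blocks Γ m e s n Ms
  splitPremises n Ms P M↭ with reorder P ≋-refl M↭
  ... | up-to P′ M′≋ Γ∼ m≡ e≡ s≡ with splitBlocks n Ms P′ M′≋
  ... | blocks Γs ms es ss block Γ′∼ m′≡ e′≡ s′≡ =
    blocks Γs ms es ss block (∼-trans Γ∼ Γ′∼) (trans m≡ m′≡) (trans e≡ e′≡) (trans s≡ s′≡)

Decomposition : Ctx → ℤ → ℤ → ℤ → Tm → (n : ℕ) → (Fin n → MTy) → Set
Decomposition Γ m e s v n Ms =
  Σ (Fin n → Ctx) λ Γs → Σ (Fin n → ℤ) λ ms → Σ (Fin n → ℤ) λ es → Σ (Fin n → ℤ) λ ss →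
  ((i : Fin n) → Σ MTy λ Ni → (Ni ≈M Ms i) × Der (Γs i) (ms i) (es i) (ss i) v (mult Ni))
  × (Γ ≈C sumCtx Γs) × (m ≡ sumℤ ms) × (e ≡ 1ℤ + sumℤ es - + n) × (s ≡ sumℤ ss)

sumℤ-0 : ∀ n → sumℤ {n} (λ _ → 0ℤ) ≡ 0ℤ
sumℤ-0 n = trans (sumℤ-const n 0ℤ) (ℤ.*-zeroʳ (+ n))

1+sumℤ-shift : ∀ n (es : Fin n → ℤ) {e} → e ≡ sumℤ es →
                  1ℤ + e ≡ 1ℤ + sumℤ (λ i → 1ℤ + es i) - + n
1+sumℤ-shift n es {e} e≡ = begin
  1ℤ + e                                    ≡⟨ cong (_+_ 1ℤ) e≡ ⟩
  1ℤ + sumℤ es                              ≡⟨ cancel (sumℤ es) (+ n) ⟩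
  1ℤ + (+ n * 1ℤ + sumℤ es) - + n           ≡⟨ cong (λ z → 1ℤ + (z + sumℤ es) - + n)
                                                    (sym (sumℤ-const n 1ℤ)) ⟩
  1ℤ + (sumℤ {n} (λ _ → 1ℤ) + sumℤ es) - + n ≡⟨ cong (λ z → 1ℤ + z - + n)
                                                    (sym (sumℤ-+ n (λ _ → 1ℤ) es)) ⟩
  1ℤ + sumℤ (λ i → 1ℤ + es i) - + n         ∎
  where
  open ≡-Reasoning
  cancel : ∀ a b → 1ℤ + a ≡ 1ℤ + (b * 1ℤ + a) - b
  cancel = solve-∀

⟨∶⟩-cong : ∀ x {M N} → M ≈M N → ⟨ x ∶ M ⟩ ≈C ⟨ x ∶ N ⟩
⟨∶⟩-cong x M≈N y with y ≡ᵇ x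
... | true  = M≈N
... | false = ≈M-refl []

var-decomposition : ∀ x {M} n (Ms : Fin n → MTy) → M ≈M ⨆ Ms →
                    Decomposition ⟨ x ∶ M ⟩ 0ℤ 1ℤ 0ℤ (var x) n Ms
var-decomposition x {M} n Ms M≈ =
  (λ i → ⟨ x ∶ Ms i ⟩) , (λ _ → 0ℤ) , (λ _ → 1ℤ) , (λ _ → 0ℤ) ,
  (λ i → Ms i , ≈M-refl (Ms i) , var-c) ,
  (λ y → subst (⟨ x ∶ M ⟩ y ≈M_) (sym (sumCtx-⟨∶⟩ n x Ms y)) (⟨∶⟩-cong x M≈ y)) ,
  sym (sumℤ-0 n) ,
  1+sumℤ-shift n (λ _ → 0ℤ) (sym (sumℤ-0 n)) ,
  sym (sumℤ-0 n)

lam-decomposition : ∀ {x t Γ m e s M} → AbsPrems x t Γ m e s M →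
                    ∀ n (Ms : Fin n → MTy) → M ≈M ⨆ Ms →
                    Decomposition Γ m (1ℤ + e) s (lam x t) n Ms
lam-decomposition P n Ms (perm M↭) with splitPremises n Ms P M↭
... | blocks Γs ms es ss block Γ∼ m≡ e≡ s≡ =
  Γs , ms , (λ i → 1ℤ + es i) , ss ,
  (λ i → let (Ni , Ni≋ , Q) = block i in Ni , perm (Homogeneous.refl Ni≋) , abs-c Q) ,
  (λ y → perm (Γ∼ y)) ,
  m≡ ,
  1+sumℤ-shift n es e≡ ,
  s≡

lemma4p5 : ∀ {v Γ m e s M} → Value v → Der Γ m e s v (mult M) →
    (n : ℕ) (Ms : Fin n → MTy) → M ≈M ⨆ Ms →
    Σ (Fin n → Ctx) λ Γs → Σ (Fin n → ℤ) λ ms → Σ (Fin n → ℤ) λ es →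
    Σ (Fin n → ℤ) λ ss →
    ((i : Fin n) → Σ MTy λ Ni → (Ni ≈M Ms i) × Der (Γs i) (ms i) (es i) (ss i) v (mult Ni))
    × (Γ ≈C sumCtx Γs)
    × (m ≡ sumℤ ms)
    × (e ≡ 1ℤ + sumℤ es - + n)
    × (s ≡ sumℤ ss)
lemma4p5 (var-val x)   var-c     = var-decomposition x
lemma4p5 (lam-val x t) (abs-c P) = lam-decomposition P
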